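{- Let $k\geq l\geq 2$ be integers and let $G$ be a properly edge-coloured graph on $n$ vertices containing no rainbow copy of $C_{2k+1}$. Assume that every edge of $G$ is contained in a rainbow copy of $C_{2l+1}$. Then for every vertex $a\in V(G)$, the number of paths $axy$ of length $2$ starting at $a$ in $G$ is $O(n)$, where the implied constant depends only on $k$ and $l$.
   Context: A proper edge-colouring assigns colours to edges so that edges sharing a vertex get different colours; a subgraph is rainbow if its edges have pairwise distinct colours. $C_m$ denotes the cycle of length $m$. -}

module Defs where

open import Data.Nat using (ℕ; zero; suc; _+_; _*_; _≤_)
open import Data.Nat.DivMod using (_%_; m%n<n)
open import Data.Fin using (Fin; toℕ; fromℕ<; _≟_)
open import Data.Product using (Σ; _×_; _,_; ∃)
open import Data.Sum using (_⊎_)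
open import Data.Bool using (Bool; true; false; _∧_; not)
open import Relation.Nullary using (¬_; does)
open import Relation.Binary using (Decidable)
open import Relation.Binary.PropositionalEquality using (_≡_; _≢_)
open import Function.Definitions using (Injective)
open import Data.List using (List; map)
open import Data.Nat.ListAction using (sum)
open import Data.List using (allFin) public

record Graph (n : ℕ) : Set₁ where
  field
    Adj    : Fin n → Fin n → Set
    adj?   : Decidable Adj
    sym    : ∀ {u v} → Adj u v → Adj v u
    irrefl : ∀ {u} → ¬ Adj u u
open Graph public

-- An edge-colouring: a colour (natural number) for each unordered pair,
-- given as a symmetric function on vertex pairs (values on non-edges irrelevant).
record EdgeColouring {n : ℕ} (G : Graph n) : Set where
  field
    col    : Fin n → Fin n → ℕ
    colSym : ∀ u v → Adj G u v → col u v ≡ col v u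
open EdgeColouring public

Proper : ∀ {n} (G : Graph n) → EdgeColouring G → Set
Proper {n} G c = ∀ (u v w : Fin n) → Adj G u v → Adj G u w → v ≢ w → col c u v ≢ col c u w

next : ∀ {m} → Fin (suc m) → Fin (suc m)
next {m} i = fromℕ< (m%n<n (suc (toℕ i)) (suc m))

record Cycle {n : ℕ} (G : Graph n) (m : ℕ) : Set where
  field
    vtx  : Fin (suc m) → Fin n
    inj  : Injective _≡_ _≡_ vtx
    edge : ∀ i → Adj G (vtx i) (vtx (next i))
open Cycle public

Rainbow : ∀ {n m} {G : Graph n} → EdgeColouring G → Cycle G m → Set
Rainbow {m = m} c C = ∀ (i j : Fin (suc m)) → i ≢ j →
  col c (vtx C i) (vtx C (next i)) ≢ col c (vtx C j) (vtx C (next j))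

-- G has a rainbow copy of C_(suc m)
HasRainbowCycle : ∀ {n} (G : Graph n) → EdgeColouring G → ℕ → Set
HasRainbowCycle G c m = Σ (Cycle G m) λ C → Rainbow c C

EdgeOf : ∀ {n m} {G : Graph n} → Cycle G m → Fin n → Fin n → Set
EdgeOf {m = m} C u v = ∃ λ (i : Fin (suc m)) →
  (vtx C i ≡ u × vtx C (next i) ≡ v) ⊎ (vtx C i ≡ v × vtx C (next i) ≡ u)

EveryEdgeInRainbowCycle : ∀ {n} (G : Graph n) → EdgeColouring G → ℕ → Set
EveryEdgeInRainbowCycle {n} G c m = ∀ (u v : Fin n) → Adj G u v →
  Σ (Cycle G m) λ C → Rainbow c C × EdgeOf C u v

-- indicator that a x y is a path of length 2 (a ~ x ~ y, y ≠ a;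
-- a ≠ x and x ≠ y follow from irreflexivity)
isPath2 : ∀ {n} (G : Graph n) → Fin n → Fin n → Fin n → Bool
isPath2 G a x y = does (adj? G a x) ∧ does (adj? G x y) ∧ not (does (y ≟ a))

bool→ℕ : Bool → ℕ
bool→ℕ true = 1
bool→ℕ false = 0

paths2From : ∀ {n} (G : Graph n) → Fin n → ℕ
paths2From {n} G a =
  sum (map (λ x → sum (map (λ y → bool→ℕ (isPath2 G a x y)) (allFin n))) (allFin n))

-- With D = 6k + 2, thin out the neighbourhood of
-- a in rounds: level 0 is N(a); a vertex y is heavy for level i if at least D vertices
-- of level i are adjacent to it; level i + 1 keeps the vertices of level i with at least
-- D heavy neighbours.  A counting argument shows that each round discards at most 2Dn
-- paths a x y.  Conversely, if x lies in level j, then an edge a x on a rainbow cycle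
-- C_(2l+1) gives a rainbow path of length 2l from x to a closed up by the edge x a, and
-- j times it can be grown by two edges (x → heavy y → u in the level below) while
-- staying closed up through a, since D exceeds the number of candidates spoilt by
-- repeated vertices or colours.  For j = k - l this gives a rainbow C_(2k+1), so level
-- k - l is empty and a starts at most 2(k - l)Dn paths of length 2.
module Submission where

open import Defs
open import Data.Nat using (ℕ; zero; suc; _+_; _*_; _∸_; _≤_; _<_; z≤n; s≤s; _≤ᵇ_; NonZero)
open import Data.Nat.Properties
  using ( module ≤-Reasoning; +-0-commutativeMonoid
        ; ≤-refl; ≤-reflexive; ≤-trans; <⇒≤; <⇒≢; ≰⇒>; ≤ᵇ⇒≤; ≤⇒≤ᵇ; m<1+n⇒m<n∨m≡n
        ; <-≤-trans; +-cancelʳ-<; +-mono-≤; +-monoʳ-≤; m≤m+n; m≤n+m; +-assoc; +-suc; *-assoc; *-zeroʳ; *-suc; n≤1+n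
        ; +-identityʳ; +-comm; *-distribˡ-+; +-∸-assoc; m+[n∸m]≡n; m∸n+n≡m; m∸n≤m; n∸n≡0; ∸-cancelˡ-≡ )
  renaming (suc-injective to ℕ-suc-injective; _≟_ to _ℕ-≟_)
open import Data.Nat.Solver using (module +-*-Solver)
open import Data.Nat.DivMod using (_%_; m%n<n; n%n≡0; m%n%n≡m%n; [m+n]%n≡m%n; m<n⇒m%n≡m; %-distribˡ-+)
open import Data.Fin using (Fin; zero; suc; toℕ; _≟_)
open import Data.Fin.Properties using (suc-injective; toℕ-injective; toℕ-fromℕ<; toℕ<n; toℕ≤pred[n])
open import Data.Bool using (Bool; true; false; _∧_; not; T)
open import Data.Bool.Properties using (T-∧)
open import Data.Unit using (tt)
open import Data.Empty using (⊥; ⊥-elim)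
open import Data.Product using (Σ; ∃; _×_; _,_; proj₁; proj₂)
open import Data.Sum using (_⊎_; inj₁; inj₂)
import Data.List as List using (map; tabulate; allFin)
open import Data.List.Properties using (map-tabulate)
import Data.Nat.ListAction as List using (sum)
open import Function using (_∘_; id)
open import Function.Bundles using (Equivalence)
open import Relation.Nullary using (¬_; Dec; yes; no; does; _×-dec_)
open import Relation.Binary.PropositionalEquality using (_≡_; _≢_; refl; trans; cong; cong₂; subst; module ≡-Reasoning) renaming (sym to ≡-sym)
open import Algebra.Properties.CommutativeMonoid.Sum +-0-commutativeMonoid
  using (∑-distrib-+; ∑-comm) renaming (sum to ∑; sum-cong-≗ to ∑-cong-≗)

∑-mono : ∀ {n} {f g : Fin n → ℕ} → (∀ u → f u ≤ g u) → ∑ f ≤ ∑ g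
∑-mono {zero}  f≤g = z≤n
∑-mono {suc n} f≤g = +-mono-≤ (f≤g zero) (∑-mono (f≤g ∘ suc))

∑-bound : ∀ {n} (f : Fin n → ℕ) (B : ℕ) → (∀ u → f u ≤ B) → ∑ f ≤ n * B
∑-bound {zero}  f B f≤B = z≤n
∑-bound {suc n} f B f≤B = +-mono-≤ (f≤B zero) (∑-bound (f ∘ suc) B (f≤B ∘ suc))

∑-vanish : ∀ {n} (f : Fin n → ℕ) → (∀ u → f u ≤ 0) → ∑ f ≤ 0
∑-vanish {n} f f≤0 = subst (∑ f ≤_) (*-zeroʳ n) (∑-bound f 0 f≤0)

∑-positive : ∀ {n} (f : Fin n → ℕ) → 0 < ∑ f → ∃ λ u → 0 < f u
∑-positive {suc n} f pos with f zero in eq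
... | suc _ = zero , subst (0 <_) (≡-sym eq) (s≤s z≤n)
... | zero  with ∑-positive (f ∘ suc) pos
...   | u , fu>0 = suc u , fu>0

listSum-allFin : ∀ {n} (f : Fin n → ℕ) → List.sum (List.map f (List.allFin n)) ≡ ∑ f
listSum-allFin f = trans (cong List.sum (map-tabulate id f)) (listSum-tabulate f)
  where
  listSum-tabulate : ∀ {n} (g : Fin n → ℕ) → List.sum (List.tabulate g) ≡ ∑ g
  listSum-tabulate {zero}  g = refl
  listSum-tabulate {suc n} g = cong (g zero +_) (listSum-tabulate (g ∘ suc))

count : ∀ {n} → (Fin n → Bool) → ℕ
count P = ∑ (λ u → bool→ℕ (P u))

AtMostOne : ∀ {n} → (Fin n → Set) → Set
AtMostOne B = ∀ {u v} → B u → B v → u ≡ v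

T-∧⁻ : ∀ {x y} → T (x ∧ y) → T x × T y
T-∧⁻ = Equivalence.to T-∧

T-does : ∀ {A : Set} (d : Dec A) → T (does d) → A
T-does (yes a) _ = a

T-not-does : ∀ {A : Set} (d : Dec A) → T (not (does d)) → ¬ A
T-not-does (no ¬a) _ = ¬a

count-witness : ∀ {n} (P : Fin n → Bool) → 0 < count P → ∃ λ u → T (P u)
count-witness P pos with ∑-positive (λ u → bool→ℕ (P u)) pos
... | u , Pu>0 = u , positive Pu>0
  where
  positive : ∀ {b} → 0 < bool→ℕ b → T b
  positive {true} _ = tt

count-atMostOne : ∀ {n} {B : Fin n → Set} (B? : ∀ u → Dec (B u)) → AtMostOne B →
                  count (does ∘ B?) ≤ 1
count-atMostOne {zero}  B? unique = z≤n
count-atMostOne {suc n} B? unique with B? zero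
... | no _   = count-atMostOne (B? ∘ suc) (λ b b′ → suc-injective (unique b b′))
... | yes b₀ = s≤s (∑-vanish _ nothing-else)
  where
  nothing-else : ∀ u → bool→ℕ (does (B? (suc u))) ≤ 0
  nothing-else u with B? (suc u)
  ... | no _  = z≤n
  ... | yes b with unique b₀ b
  ...   | ()

count-remove : ∀ {n} (P : Fin n → Bool) {B : Fin n → Set} (B? : ∀ u → Dec (B u)) →
               AtMostOne B → count P ≤ count (λ u → P u ∧ not (does (B? u))) + 1
count-remove {n} P B? unique = begin
  count P                                              ≤⟨ ∑-mono (λ u → split (P u) (does (B? u))) ⟩
  ∑ (λ u → bool→ℕ (Q u) + bool→ℕ (does (B? u)))        ≡⟨ ∑-distrib-+ (λ u → bool→ℕ (Q u)) (λ u → bool→ℕ (does (B? u))) ⟩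
  count Q + count (does ∘ B?)                          ≤⟨ +-monoʳ-≤ (count Q) (count-atMostOne B? unique) ⟩
  count Q + 1                                          ∎
  where
  open ≤-Reasoning
  Q : Fin n → Bool
  Q u = P u ∧ not (does (B? u))
  split : ∀ p b → bool→ℕ p ≤ bool→ℕ (p ∧ not b) + bool→ℕ b
  split false b     = z≤n
  split true  false = s≤s z≤n
  split true  true  = s≤s z≤n

avoiding : ∀ {n} (P : Fin n → Bool) {B : ℕ → Fin n → Set} → (∀ t u → Dec (B t u)) → ℕ → Fin n → Bool
avoiding P B? zero    u = P u
avoiding P B? (suc m) u = avoiding P B? m u ∧ not (does (B? m u))

avoiding-sound : ∀ {n} (P : Fin n → Bool) {B : ℕ → Fin n → Set} (B? : ∀ t u → Dec (B t u)) m {u} →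
                 T (avoiding P B? m u) → T (P u) × (∀ t → t < m → ¬ B t u)
avoiding-sound P B? zero    Pu = Pu , λ _ ()
avoiding-sound P {B} B? (suc m) {u} Qu with T-∧⁻ Qu
... | Qmu , ¬Bm with avoiding-sound P B? m Qmu
...   | Pu , ¬B = Pu , avoids
  where
  avoids : ∀ t → t < suc m → ¬ B t u
  avoids t t<1+m with m<1+n⇒m<n∨m≡n t<1+m
  ... | inj₁ t<m  = ¬B t t<m
  ... | inj₂ refl = T-not-does (B? t u) ¬Bm

count-avoiding : ∀ {n} (P : Fin n → Bool) {B : ℕ → Fin n → Set} (B? : ∀ t u → Dec (B t u)) →
                 (∀ t → AtMostOne (B t)) → ∀ m → count P ≤ count (avoiding P B? m) + m
count-avoiding P B? unique zero    = m≤m+n (count P) 0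
count-avoiding P B? unique (suc m) = begin
  count P                                   ≤⟨ count-avoiding P B? unique m ⟩
  count (avoiding P B? m) + m               ≤⟨ +-mono-≤ (count-remove (avoiding P B? m) (B? m) (unique m)) ≤-refl ⟩
  count (avoiding P B? (suc m)) + 1 + m     ≡⟨ +-assoc _ 1 m ⟩
  count (avoiding P B? (suc m)) + suc m     ∎
  where open ≤-Reasoning

module Levels {n : ℕ} (G : Graph n) (a : Fin n) (D : ℕ) where

  Step : Fin n → Fin n → Bool
  Step x y = does (adj? G x y) ∧ not (does (y ≟ a))

  level : ℕ → Fin n → Bool
  heavy : ℕ → Fin n → Bool

  heavy i y = D ≤ᵇ ∑ (λ x → bool→ℕ (level i x ∧ Step x y))

  level zero    x = does (adj? G a x)
  level (suc i) x = level i x ∧ (D ≤ᵇ ∑ (λ y → bool→ℕ (heavy i y ∧ Step x y)))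

  levelPaths : ℕ → ℕ
  levelPaths i = ∑ (λ x → ∑ (λ y → bool→ℕ (level i x ∧ Step x y)))

  split-step : ∀ l x y → T (l ∧ Step x y) → T l × Adj G x y
  split-step l x y t = proj₁ (T-∧⁻ {l} t) , T-does (adj? G x y) (proj₁ (T-∧⁻ (proj₂ (T-∧⁻ {l} t))))

  level⇒adjacent : ∀ i x → T (level i x) → Adj G a x
  level⇒adjacent zero    x ax = T-does (adj? G a x) ax
  level⇒adjacent (suc i) x lx = level⇒adjacent i x (proj₁ (T-∧⁻ lx))

  below-threshold : ∀ {s} → ¬ T (D ≤ᵇ s) → s < D
  below-threshold fails = ≰⇒> (fails ∘ ≤⇒≤ᵇ)

  light-bound : ∀ i y → ∑ (λ x → bool→ℕ (not (heavy i y) ∧ (level i x ∧ Step x y))) ≤ D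
  light-bound i y with heavy i y in h
  ... | true  = ≤-trans (∑-vanish {n} (λ _ → 0) (λ _ → z≤n)) z≤n
  ... | false = <⇒≤ (below-threshold (subst T h))

  -- a vertex of level i either survives to level i + 1 or has fewer than D heavy steps
  heavy-bound : ∀ i x → ∑ (λ y → bool→ℕ (level i x ∧ (heavy i y ∧ Step x y)))
                        ≤ ∑ (λ y → bool→ℕ (level (suc i) x ∧ Step x y)) + D
  heavy-bound i x with level i x
  ... | false = ≤-trans (∑-vanish {n} (λ _ → 0) (λ _ → z≤n)) z≤n
  ... | true with D ≤ᵇ ∑ (λ y → bool→ℕ (heavy i y ∧ Step x y)) in survives
  ...   | true  = ≤-trans (∑-mono (λ y → drop-heavy (heavy i y) (Step x y))) (m≤m+n _ D)
    where
    drop-heavy : ∀ h s → bool→ℕ (h ∧ s) ≤ bool→ℕ s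
    drop-heavy true  s = ≤-refl
    drop-heavy false s = z≤n
  ...   | false = ≤-trans (<⇒≤ (below-threshold (subst T survives))) (m≤n+m D _)

  -- One round of thinning discards at most 2Dn paths: a path a x y with x in level i
  -- either has y heavy (then x survives, or x has fewer than D such y) or has y light
  -- (and a light y is reached from fewer than D vertices x).
  round-loss : ∀ i → levelPaths i ≤ levelPaths (suc i) + (D + D) * n
  round-loss i = begin
    levelPaths i
      ≤⟨ ∑-mono (λ x → ∑-mono (λ y → split (level i x) (heavy i y) (Step x y))) ⟩
    ∑ (λ x → ∑ (λ y → survivor x y + discarded x y))
      ≡⟨ ∑-cong-≗ (λ x → ∑-distrib-+ (survivor x) (discarded x)) ⟩
    ∑ (λ x → ∑ (survivor x) + ∑ (discarded x))
      ≡⟨ ∑-distrib-+ (λ x → ∑ (survivor x)) (λ x → ∑ (discarded x)) ⟩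
    ∑ (λ x → ∑ (survivor x)) + ∑ (λ x → ∑ (discarded x))
      ≡⟨ cong (∑ (λ x → ∑ (survivor x)) +_) (∑-comm discarded) ⟩
    ∑ (λ x → ∑ (survivor x)) + ∑ (λ y → ∑ (λ x → discarded x y))
      ≤⟨ +-mono-≤ (∑-mono (heavy-bound i)) (∑-bound _ D (light-bound i)) ⟩
    ∑ (λ x → ∑ (λ y → bool→ℕ (level (suc i) x ∧ Step x y)) + D) + n * D
      ≡⟨ cong (_+ n * D) (∑-distrib-+ (λ x → ∑ (λ y → bool→ℕ (level (suc i) x ∧ Step x y))) (λ _ → D)) ⟩
    levelPaths (suc i) + ∑ {n} (λ _ → D) + n * D
      ≤⟨ +-mono-≤ (+-monoʳ-≤ (levelPaths (suc i)) (∑-bound {n} (λ _ → D) D (λ _ → ≤-refl))) ≤-refl ⟩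
    levelPaths (suc i) + n * D + n * D
      ≡⟨ solve 3 (λ p n D → p :+ n :* D :+ n :* D := p :+ (D :+ D) :* n) refl (levelPaths (suc i)) n D ⟩
    levelPaths (suc i) + (D + D) * n ∎
    where
    open ≤-Reasoning
    open +-*-Solver
    survivor discarded : Fin n → Fin n → ℕ
    survivor  x y = bool→ℕ (level i x ∧ (heavy i y ∧ Step x y))
    discarded x y = bool→ℕ (not (heavy i y) ∧ (level i x ∧ Step x y))
    split : ∀ l h s → bool→ℕ (l ∧ s) ≤ bool→ℕ (l ∧ (h ∧ s)) + bool→ℕ (not h ∧ (l ∧ s))
    split false h     s     = z≤n
    split true  h     false = z≤n
    split true  true  true  = s≤s z≤n
    split true  false true  = s≤s z≤n

  rounds-loss : ∀ j → levelPaths 0 ≤ levelPaths j + j * ((D + D) * n)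
  rounds-loss zero    = m≤m+n (levelPaths 0) 0
  rounds-loss (suc j) = begin
    levelPaths 0                          ≤⟨ rounds-loss j ⟩
    levelPaths j + j * loss               ≤⟨ +-mono-≤ (round-loss j) ≤-refl ⟩
    levelPaths (suc j) + loss + j * loss  ≡⟨ +-assoc (levelPaths (suc j)) loss (j * loss) ⟩
    levelPaths (suc j) + suc j * loss     ∎
    where
    open ≤-Reasoning
    loss : ℕ
    loss = (D + D) * n

  levelPaths-empty : ∀ j → (∀ x → ¬ T (level j x)) → levelPaths j ≤ 0
  levelPaths-empty j empty = ∑-vanish _ (λ x → ∑-vanish _ (λ y → none x y))
    where
    none : ∀ x y → bool→ℕ (level j x ∧ Step x y) ≤ 0
    none x y with level j x in lx
    ... | true  = ⊥-elim (empty x (subst T (≡-sym lx) tt))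
    ... | false = z≤n

  paths2From-level0 : paths2From G a ≡ levelPaths 0
  paths2From-level0 = trans (listSum-allFin (λ x → List.sum (List.map (path x) (List.allFin n))))
                            (∑-cong-≗ (λ x → listSum-allFin (path x)))
    where
    path : Fin n → Fin n → ℕ
    path x y = bool→ℕ (isPath2 G a x y)

  paths-bound : ∀ j → (∀ x → ¬ T (level j x)) → paths2From G a ≤ j * (D + D) * n
  paths-bound j empty = begin
    paths2From G a                     ≡⟨ paths2From-level0 ⟩
    levelPaths 0                       ≤⟨ rounds-loss j ⟩
    levelPaths j + j * ((D + D) * n)   ≤⟨ +-mono-≤ (levelPaths-empty j empty) ≤-refl ⟩
    j * ((D + D) * n)                  ≡⟨ *-assoc j (D + D) n ⟨
    j * (D + D) * n                    ∎
    where open ≤-Reasoning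

%-absorbʳ : ∀ y z M .{{_ : NonZero M}} → (y + z % M) % M ≡ (y + z) % M
%-absorbʳ y z M = begin
  (y + z % M) % M           ≡⟨ %-distribˡ-+ y (z % M) M ⟩
  (y % M + z % M % M) % M   ≡⟨ cong (λ w → (y % M + w) % M) (m%n%n≡m%n z M) ⟩
  (y % M + z % M) % M       ≡⟨ %-distribˡ-+ y z M ⟨
  (y + z) % M               ∎
  where open ≡-Reasoning

%-cancelˡ : ∀ {M} .{{_ : NonZero M}} x {s t} → x ≤ M → s < M → t < M →
            (x + s) % M ≡ (x + t) % M → s ≡ t
%-cancelˡ {M} x {s} {t} x≤M s<M t<M e = begin
  s                             ≡⟨ undo s<M ⟨
  ((M ∸ x) + (x + s)) % M       ≡⟨ %-absorbʳ (M ∸ x) (x + s) M ⟨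
  ((M ∸ x) + (x + s) % M) % M   ≡⟨ cong (λ w → ((M ∸ x) + w) % M) e ⟩
  ((M ∸ x) + (x + t) % M) % M   ≡⟨ %-absorbʳ (M ∸ x) (x + t) M ⟩
  ((M ∸ x) + (x + t)) % M       ≡⟨ undo t<M ⟩
  t                             ∎
  where
  open ≡-Reasoning
  undo : ∀ {r} → r < M → ((M ∸ x) + (x + r)) % M ≡ r
  undo {r} r<M = begin
    ((M ∸ x) + (x + r)) % M   ≡⟨ cong (_% M) (+-assoc (M ∸ x) x r) ⟨
    ((M ∸ x) + x + r) % M     ≡⟨ cong (λ w → (w + r) % M) (m∸n+n≡m x≤M) ⟩
    (M + r) % M               ≡⟨ cong (_% M) (+-comm M r) ⟩
    (r + M) % M               ≡⟨ [m+n]%n≡m%n r M ⟩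
    r % M                     ≡⟨ m<n⇒m%n≡m r<M ⟩
    r                         ∎

toℕ-next : ∀ {m} (i : Fin (suc m)) → toℕ (next i) ≡ suc (toℕ i) % suc m
toℕ-next {m} i = toℕ-fromℕ< (m%n<n (suc (toℕ i)) (suc m))

next-view : ∀ {m} (i : Fin (suc m)) →
            (toℕ i < m × toℕ (next i) ≡ suc (toℕ i)) ⊎ (toℕ i ≡ m × toℕ (next i) ≡ 0)
next-view {m} i with m<1+n⇒m<n∨m≡n (toℕ<n i)
... | inj₁ i<m  = inj₁ (i<m , trans (toℕ-next i) (m<n⇒m%n≡m (s≤s i<m)))
... | inj₂ i≡m  = inj₂ (i≡m , trans (toℕ-next i) (trans (cong (λ z → suc z % suc m) i≡m) (n%n≡0 (suc m))))

iter : ∀ {m} → Fin (suc m) → ℕ → Fin (suc m)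
iter i zero    = i
iter i (suc t) = next (iter i t)

toℕ-iter : ∀ {m} (i : Fin (suc m)) t → toℕ (iter i t) ≡ (toℕ i + t) % suc m
toℕ-iter {m} i zero = ≡-sym (trans (cong (_% suc m) (+-identityʳ (toℕ i))) (m<n⇒m%n≡m (toℕ<n i)))
toℕ-iter {m} i (suc t) = begin
  toℕ (next (iter i t))          ≡⟨ toℕ-next (iter i t) ⟩
  suc (toℕ (iter i t)) % suc m   ≡⟨ cong (λ z → suc z % suc m) (toℕ-iter i t) ⟩
  (1 + (toℕ i + t) % suc m) % suc m  ≡⟨ %-absorbʳ 1 (toℕ i + t) (suc m) ⟩
  suc (toℕ i + t) % suc m        ≡⟨ cong (_% suc m) (+-suc (toℕ i) t) ⟨
  (toℕ i + suc t) % suc m        ∎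
  where open ≡-Reasoning

iter-around : ∀ {m} (i : Fin (suc m)) → iter i (suc m) ≡ i
iter-around {m} i = toℕ-injective
  (trans (toℕ-iter i (suc m)) (trans ([m+n]%n≡m%n (toℕ i) (suc m)) (m<n⇒m%n≡m (toℕ<n i))))

iter-injective : ∀ {m} (i : Fin (suc m)) {s t} → s ≤ m → t ≤ m → iter i (suc s) ≡ iter i (suc t) → s ≡ t
iter-injective {m} i {s} {t} s≤m t≤m e =
  %-cancelˡ (suc (toℕ i)) (toℕ<n i) (s≤s s≤m) (s≤s t≤m)
    (trans (≡-sym (position s)) (trans (cong toℕ e) (position t)))
  where
  position : ∀ r → toℕ (iter i (suc r)) ≡ (suc (toℕ i) + r) % suc m
  position r = trans (toℕ-iter i (suc r)) (cong (_% suc m) (+-suc (toℕ i) r))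

-- A path of length L is read off a map p : ℕ → Fin n on 0, …, L.  Paths grow at the
-- end p 0, so that extending by a vertex is definitional: (u ◂ p) (suc t) = p t.
module RainbowPaths {n : ℕ} (G : Graph n) (c : EdgeColouring G) where

  infixr 5 _◂_
  _◂_ : Fin n → (ℕ → Fin n) → ℕ → Fin n
  (u ◂ p) zero    = u
  (u ◂ p) (suc t) = p t

  edgeColour : (ℕ → Fin n) → ℕ → ℕ
  edgeColour p t = col c (p t) (p (suc t))

  NewVertex : ℕ → (ℕ → Fin n) → Fin n → Set
  NewVertex L p u = ∀ t → t ≤ L → u ≢ p t

  NewColour : ℕ → (ℕ → Fin n) → ℕ → Set
  NewColour L p κ = ∀ t → t < L → κ ≢ edgeColour p t

  record RainbowPath (L : ℕ) (p : ℕ → Fin n) : Set where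
    field
      adjacent          : ∀ t → t < L → Adj G (p t) (p (suc t))
      vertices-distinct : ∀ s t → s ≤ L → t ≤ L → p s ≡ p t → s ≡ t
      colours-distinct  : ∀ s t → s < L → t < L → edgeColour p s ≡ edgeColour p t → s ≡ t
  open RainbowPath public

  prepend : ∀ {L p u} → RainbowPath L p → Adj G u (p 0) → NewVertex L p u →
            NewColour L p (col c u (p 0)) → RainbowPath (suc L) (u ◂ p)
  prepend {L} {p} {u} P u~p₀ u-new κ-new = record
    { adjacent = adj ; vertices-distinct = vtx-distinct ; colours-distinct = col-distinct }
    where
    adj : ∀ t → t < suc L → Adj G ((u ◂ p) t) ((u ◂ p) (suc t))
    adj zero    _         = u~p₀
    adj (suc t) (s≤s t<L) = adjacent P t t<L
    vtx-distinct : ∀ s t → s ≤ suc L → t ≤ suc L → (u ◂ p) s ≡ (u ◂ p) t → s ≡ t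
    vtx-distinct zero    zero    _         _         _ = refl
    vtx-distinct zero    (suc t) _         (s≤s t≤L) e = ⊥-elim (u-new t t≤L e)
    vtx-distinct (suc s) zero    (s≤s s≤L) _         e = ⊥-elim (u-new s s≤L (≡-sym e))
    vtx-distinct (suc s) (suc t) (s≤s s≤L) (s≤s t≤L) e = cong suc (vertices-distinct P s t s≤L t≤L e)
    col-distinct : ∀ s t → s < suc L → t < suc L →
                   edgeColour (u ◂ p) s ≡ edgeColour (u ◂ p) t → s ≡ t
    col-distinct zero    zero    _         _         _ = refl
    col-distinct zero    (suc t) _         (s≤s t<L) e = ⊥-elim (κ-new t t<L e)
    col-distinct (suc s) zero    (s≤s s<L) _         e = ⊥-elim (κ-new s s<L (≡-sym e))
    col-distinct (suc s) (suc t) (s≤s s<L) (s≤s t<L) e = cong suc (colours-distinct P s t s<L t<L e)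

  -- A rainbow path whose ends are joined by an edge of yet another colour: a rainbow
  -- cycle of length m + 1 cut open at that edge.
  record ClosedRainbowPath (m : ℕ) (p : ℕ → Fin n) : Set where
    field
      path        : RainbowPath m p
      closing     : Adj G (p m) (p 0)
      closing-new : NewColour m p (col c (p m) (p 0))
  open ClosedRainbowPath public

  -- Position t of the reversed path is position m - t; its t-th edge is edge m - 1 - t.
  reflect : ∀ {m t} → t < m → m ∸ t ≡ suc (m ∸ suc t)
  reflect t<m = +-∸-assoc 1 t<m

  reflect-< : ∀ {m t} → t < m → m ∸ suc t < m
  reflect-< {m} {t} t<m = subst (_≤ m) (reflect t<m) (m∸n≤m m t)

  reverse : ∀ {m p} → ClosedRainbowPath m p → ClosedRainbowPath m (λ t → p (m ∸ t))
  reverse {m} {p} C = record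
    { path        = record { adjacent = adj ; vertices-distinct = vtx-distinct ; colours-distinct = col-distinct }
    ; closing     = subst (λ z → Adj G (p z) (p m)) (≡-sym (n∸n≡0 m)) (Graph.sym G (closing C))
    ; closing-new = λ t t<m e → closing-new C (m ∸ suc t) (reflect-< t<m)
                      (trans (colSym c (p m) (p 0) (closing C))
                        (trans (cong (λ z → col c (p z) (p m)) (≡-sym (n∸n≡0 m))) (trans e (edge-reversed t<m)))) }
    where
    q : ℕ → Fin n
    q t = p (m ∸ t)
    back-edge : ∀ {t} (t<m : t < m) → Adj G (p (suc (m ∸ suc t))) (p (m ∸ suc t))
    back-edge t<m = Graph.sym G (adjacent (path C) _ (reflect-< t<m))
    edge-reversed : ∀ {t} → t < m → edgeColour q t ≡ edgeColour p (m ∸ suc t)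
    edge-reversed {t} t<m = trans (cong (λ z → col c (p z) (p (m ∸ suc t))) (reflect t<m))
                                  (colSym c _ _ (back-edge t<m))
    adj : ∀ t → t < m → Adj G (q t) (q (suc t))
    adj t t<m = subst (λ z → Adj G (p z) (p (m ∸ suc t))) (≡-sym (reflect t<m)) (back-edge t<m)
    vtx-distinct : ∀ s t → s ≤ m → t ≤ m → q s ≡ q t → s ≡ t
    vtx-distinct s t s≤m t≤m e =
      ∸-cancelˡ-≡ s≤m t≤m (vertices-distinct (path C) _ _ (m∸n≤m m s) (m∸n≤m m t) e)
    col-distinct : ∀ s t → s < m → t < m → edgeColour q s ≡ edgeColour q t → s ≡ t
    col-distinct s t s<m t<m e = ℕ-suc-injective (∸-cancelˡ-≡ s<m t<m
      (colours-distinct (path C) _ _ (reflect-< s<m) (reflect-< t<m)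
        (trans (≡-sym (edge-reversed s<m)) (trans e (edge-reversed t<m)))))

  closed⇒cycle : ∀ {m p} → ClosedRainbowPath m p → HasRainbowCycle G c m
  closed⇒cycle {m} {p} C = record { vtx = v ; inj = v-injective ; edge = v-edge } , v-rainbow
    where
    v : Fin (suc m) → Fin n
    v i = p (toℕ i)
    v-injective : ∀ {i j} → v i ≡ v j → i ≡ j
    v-injective {i} {j} e =
      toℕ-injective (vertices-distinct (path C) _ _ (toℕ≤pred[n] i) (toℕ≤pred[n] j) e)
    v-edge : ∀ i → Adj G (v i) (v (next i))
    v-edge i with next-view i
    ... | inj₁ (i<m , ni) rewrite ni = adjacent (path C) (toℕ i) i<m
    ... | inj₂ (i≡m , ni) rewrite ni | i≡m = closing C
    colour-view : ∀ i → (toℕ i < m × col c (v i) (v (next i)) ≡ edgeColour p (toℕ i))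
                      ⊎ (toℕ i ≡ m × col c (v i) (v (next i)) ≡ col c (p m) (p 0))
    colour-view i with next-view i
    ... | inj₁ (i<m , ni) = inj₁ (i<m , cong (λ z → col c (v i) (p z)) ni)
    ... | inj₂ (i≡m , ni) = inj₂ (i≡m , cong₂ (λ z w → col c (p z) (p w)) i≡m ni)
    v-rainbow : Rainbow c (record { vtx = v ; inj = v-injective ; edge = v-edge })
    v-rainbow i j i≢j e with colour-view i | colour-view j
    ... | inj₁ (i<m , ei) | inj₁ (j<m , ej) =
          i≢j (toℕ-injective (colours-distinct (path C) _ _ i<m j<m (trans (≡-sym ei) (trans e ej))))
    ... | inj₁ (i<m , ei) | inj₂ (_ , ej)   = closing-new C _ i<m (trans (≡-sym ej) (trans (≡-sym e) ei))
    ... | inj₂ (_ , ei)   | inj₁ (j<m , ej) = closing-new C _ j<m (trans (≡-sym ei) (trans e ej))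
    ... | inj₂ (i≡m , _)  | inj₂ (j≡m , _)  = i≢j (toℕ-injective (trans i≡m (≡-sym j≡m)))

  cycle⇒closed : ∀ {m} (C : Cycle G m) → Rainbow c C → (i : Fin (suc m)) →
                 ClosedRainbowPath m (λ t → vtx C (iter i (suc t)))
  cycle⇒closed {m} C rainbow i = record
    { path        = record { adjacent = λ t _ → edge C (iter i (suc t))
                           ; vertices-distinct = λ s t s≤m t≤m e → iter-injective i s≤m t≤m (inj C e)
                           ; colours-distinct = col-distinct }
    ; closing     = subst (λ z → Adj G (vtx C z) (vtx C (next i))) (≡-sym (iter-around i)) (edge C i)
    ; closing-new = closing-new′ }
    where
    p : ℕ → Fin n
    p t = vtx C (iter i (suc t))
    col-distinct : ∀ s t → s < m → t < m → edgeColour p s ≡ edgeColour p t → s ≡ t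
    col-distinct s t s<m t<m e with iter i (suc s) ≟ iter i (suc t)
    ... | yes same = iter-injective i (<⇒≤ s<m) (<⇒≤ t<m) same
    ... | no differ = ⊥-elim (rainbow _ _ differ e)
    closing-new′ : NewColour m p (col c (p m) (p 0))
    closing-new′ t t<m e = rainbow i (iter i (suc t)) i≢ (trans (cong (λ z → col c (vtx C z) (vtx C (next i))) (≡-sym (iter-around i))) e)
      where
      i≢ : i ≢ iter i (suc t)
      i≢ same = <⇒≢ t<m (≡-sym (iter-injective i ≤-refl (<⇒≤ t<m) (trans (iter-around i) same)))

  loop-through : ∀ {m} (C : Cycle G m) → Rainbow c C → ∀ {a x} → EdgeOf C a x →
                 Σ (ℕ → Fin n) λ p → ClosedRainbowPath m p × p 0 ≡ x × p m ≡ a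
  loop-through {m} C rainbow (i , inj₁ (vi≡a , vni≡x)) =
    _ , cycle⇒closed C rainbow i , vni≡x , trans (cong (vtx C) (iter-around i)) vi≡a
  loop-through {m} C rainbow (i , inj₂ (vi≡x , vni≡a)) =
    _ , reverse (cycle⇒closed C rainbow i) ,
    trans (cong (vtx C) (iter-around i)) vi≡x , trans (cong (λ z → vtx C (iter i (suc z))) (n∸n≡0 m)) vni≡a

  ColouredNeighbour : Fin n → ℕ → Fin n → Set
  ColouredNeighbour w κ u = Adj G w u × col c w u ≡ κ

  coloured-neighbour? : ∀ w κ u → Dec (ColouredNeighbour w κ u)
  coloured-neighbour? w κ u = adj? G w u ×-dec (col c w u ℕ-≟ κ)

  record FreshNeighbour (L : ℕ) (p : ℕ → Fin n) (w : Fin n) (P : Fin n → Bool) : Set where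
    field
      vertex        : Fin n
      candidate     : T (P vertex)
      new-vertex    : NewVertex L p vertex
      new-colour    : NewColour L p (col c vertex (p 0))
      new-colour-at : Adj G w vertex → NewColour L p (col c w vertex)

  module _ (proper : Proper G c) where

    coloured-neighbour-unique : ∀ w κ → AtMostOne (ColouredNeighbour w κ)
    coloured-neighbour-unique w κ {u} {v} (w~u , wu≡κ) (w~v , wv≡κ) with u ≟ v
    ... | yes u≡v = u≡v
    ... | no  u≢v = ⊥-elim (proper w u v w~u w~v u≢v (trans wu≡κ (≡-sym wv≡κ)))

    -- Among more than 3L + 1 candidate neighbours of the end of a rainbow path of length
    -- L there is a fresh one: only L + 1 vertices lie on the path, and each of the L
    -- path colours occurs at most once at p 0 and at most once at w.
    fresh-neighbour : ∀ {L p} (w : Fin n) (P : Fin n → Bool) →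
                      (∀ u → T (P u) → Adj G (p 0) u) → suc L + (L + L) < count P →
                      FreshNeighbour L p w P
    fresh-neighbour {L} {p} w P P⇒adj many = record
      { vertex = u ; candidate = Pu ; new-vertex = λ t t≤L → ¬on-path t (s≤s t≤L)
      ; new-colour = new-at-end ; new-colour-at = new-at-w }
      where
      on-path? : ∀ t u → Dec (u ≡ p t)
      on-path? t u = u ≟ p t
      at-end? : ∀ t u → Dec (ColouredNeighbour (p 0) (edgeColour p t) u)
      at-end? t = coloured-neighbour? (p 0) (edgeColour p t)
      at-w? : ∀ t u → Dec (ColouredNeighbour w (edgeColour p t) u)
      at-w? t = coloured-neighbour? w (edgeColour p t)
      Q₁ Q₂ Q₃ : Fin n → Bool
      Q₁ = avoiding P  on-path? (suc L)
      Q₂ = avoiding Q₁ at-end? L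
      Q₃ = avoiding Q₂ at-w? L
      lost : ℕ
      lost = suc L + (L + L)
      Q₃-large : count P ≤ count Q₃ + lost
      Q₃-large = begin
        count P                   ≤⟨ count-avoiding P on-path? (λ t e e′ → trans e (≡-sym e′)) (suc L) ⟩
        count Q₁ + suc L          ≤⟨ +-mono-≤ (count-avoiding Q₁ at-end? (λ t → coloured-neighbour-unique (p 0) _) L) ≤-refl ⟩
        count Q₂ + L + suc L      ≤⟨ +-mono-≤ (+-mono-≤ (count-avoiding Q₂ at-w? (λ t → coloured-neighbour-unique w _) L) ≤-refl) ≤-refl ⟩
        count Q₃ + L + L + suc L  ≡⟨ solve 2 (λ q L → q :+ L :+ L :+ (con 1 :+ L) := q :+ ((con 1 :+ L) :+ (L :+ L))) refl (count Q₃) L ⟩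
        count Q₃ + lost           ∎
        where
        open ≤-Reasoning
        open +-*-Solver
      found : ∃ λ u → T (Q₃ u)
      found = count-witness Q₃ (+-cancelʳ-< lost 0 (count Q₃) (<-≤-trans many Q₃-large))
      u : Fin n
      u = proj₁ found
      sound₃ : T (Q₂ u) × (∀ t → t < L → ¬ ColouredNeighbour w (edgeColour p t) u)
      sound₃ = avoiding-sound Q₂ at-w? L (proj₂ found)
      sound₂ : T (Q₁ u) × (∀ t → t < L → ¬ ColouredNeighbour (p 0) (edgeColour p t) u)
      sound₂ = avoiding-sound Q₁ at-end? L (proj₁ sound₃)
      sound₁ : T (P u) × (∀ t → t < suc L → ¬ u ≡ p t)
      sound₁ = avoiding-sound P on-path? (suc L) (proj₁ sound₂)
      Pu : T (P u)
      Pu = proj₁ sound₁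
      ¬on-path : ∀ t → t < suc L → ¬ u ≡ p t
      ¬on-path = proj₂ sound₁
      new-at-end : NewColour L p (col c u (p 0))
      new-at-end t t<L e = proj₂ sound₂ t t<L
        (P⇒adj u Pu , trans (colSym c (p 0) u (P⇒adj u Pu)) e)
      new-at-w : Adj G w u → NewColour L p (col c w u)
      new-at-w w~u t t<L e = proj₂ sound₃ t t<L (w~u , e)

-- A closed rainbow path of length 2l grown through k - l levels has length 2k.
lengths-match : ∀ {k l} → l ≤ k → 2 * l + 2 * (k ∸ l) ≡ 2 * k
lengths-match {k} {l} l≤k = trans (≡-sym (*-distribˡ-+ 2 l (k ∸ l))) (cong (2 *_) (m+[n∸m]≡n l≤k))

-- A path with i + 1 rounds of growth to go equals one two edges longer with i to go.
two-more : ∀ m i → m + 2 * suc i ≡ suc (suc m) + 2 * i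
two-more m i = trans (cong (m +_) (*-suc 2 i)) (trans (+-suc m _) (cong suc (+-suc m (2 * i))))

-- The degree threshold used for a forbidden rainbow cycle of length K + 1: it leaves room
-- for the 3L + 1 < 3K + 2 excluded candidates of fresh-neighbour.
threshold : ℕ → ℕ
threshold K = suc (suc K + (K + K))

-- With no rainbow cycle of length K + 1, a closed rainbow path from a vertex of level i
-- back to a cannot have length K - 2i: each level lets it grow by two edges (to a heavy
-- vertex y and on to a vertex u of the previous level, closing up again through the
-- edge u a), until a rainbow cycle of length K + 1 appears.
module Growth {n : ℕ} (G : Graph n) (c : EdgeColouring G) (proper : Proper G c)
              (K : ℕ) (no-rainbow : ¬ HasRainbowCycle G c K) (a : Fin n) where

  open RainbowPaths G c
  open Levels G a (threshold K) public

  room : ∀ {L} → L ≤ K → suc L + (L + L) < threshold K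
  room L≤K = s≤s (+-mono-≤ (s≤s L≤K) (+-mono-≤ L≤K L≤K))

  many-candidates : ∀ {L s} → L ≤ K → T (threshold K ≤ᵇ s) → suc L + (L + L) < s
  many-candidates {s = s} L≤K passes = <-≤-trans (room L≤K) (≤ᵇ⇒≤ (threshold K) s passes)

  climb : ∀ {i m p} → ClosedRainbowPath m p → p m ≡ a → T (level (suc i) (p 0)) → suc m ≤ K →
          Σ (Fin n) λ u → Σ (Fin n) λ y → ClosedRainbowPath (suc (suc m)) (u ◂ y ◂ p) × T (level i u)
  climb {i} {m} {p} C pm≡a x-in m<K = u , y , record
    { path = path-u ; closing = a~u′ ; closing-new = closing-new-u } , proj₁ u-split
    where
    x : Fin n
    x = p 0
    first : FreshNeighbour m p a (λ y → heavy i y ∧ Step x y)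
    first = fresh-neighbour proper a _ (λ y hy → proj₂ (split-step (heavy i y) x y hy))
              (many-candidates (<⇒≤ m<K) (proj₂ (T-∧⁻ {level i x} x-in)))
    open FreshNeighbour first using ()
      renaming (vertex to y; candidate to y-cand; new-vertex to y-new; new-colour to y-colour)
    y-split : T (heavy i y) × Adj G x y
    y-split = split-step (heavy i y) x y y-cand
    path-y : RainbowPath (suc m) (y ◂ p)
    path-y = prepend (path C) (Graph.sym G (proj₂ y-split)) y-new y-colour
    second : FreshNeighbour (suc m) (y ◂ p) a (λ u → level i u ∧ Step u y)
    second = fresh-neighbour proper a _ (λ u lu → Graph.sym G (proj₂ (split-step (level i u) u y lu)))
               (many-candidates m<K (proj₁ y-split))
    open FreshNeighbour second using ()
      renaming (vertex to u; candidate to u-cand; new-vertex to u-new; new-colour to u-colour;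
                new-colour-at to u-colour-at)
    u-split : T (level i u) × Adj G u y
    u-split = split-step (level i u) u y u-cand
    path-u : RainbowPath (suc (suc m)) (u ◂ y ◂ p)
    path-u = prepend path-y (proj₂ u-split) u-new u-colour
    -- step 3: close up through the edge a u, whose colour differs from that of u y by
    -- properness (y ≠ a) and from the older path colours by the choice of u
    a~u : Adj G a u
    a~u = level⇒adjacent i u (proj₁ u-split)
    a~u′ : Adj G (p m) u
    a~u′ = subst (λ z → Adj G z u) (≡-sym pm≡a) a~u
    a≢y : a ≢ y
    a≢y a≡y = y-new m ≤-refl (≡-sym (trans pm≡a a≡y))
    au≡ : col c (p m) u ≡ col c u a
    au≡ = trans (cong (λ z → col c z u) pm≡a) (colSym c a u a~u)
    closing-new-u : NewColour (suc (suc m)) (u ◂ y ◂ p) (col c (p m) u)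
    closing-new-u zero    _             e = proper u a y (Graph.sym G a~u) (proj₂ u-split) a≢y
                                              (trans (≡-sym au≡) e)
    closing-new-u (suc t) (s≤s t<1+m) e = u-colour-at a~u t t<1+m
                                              (trans (cong (λ z → col c z u) (≡-sym pm≡a)) e)

  no-loop : ∀ i {m p} → ClosedRainbowPath m p → p m ≡ a → T (level i (p 0)) → m + 2 * i ≡ K → ⊥
  no-loop zero {m} C _ _ m+0≡K =
    no-rainbow (subst (HasRainbowCycle G c) (trans (≡-sym (+-identityʳ m)) m+0≡K) (closed⇒cycle C))
  no-loop (suc i) {m} {p} C pm≡a x-in length = continue (climb {i} C pm≡a x-in shorter)
    where
    length′ : suc (suc m) + 2 * i ≡ K
    length′ = trans (≡-sym (two-more m i)) length
    shorter : suc m ≤ K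
    shorter = subst (suc m ≤_) length′ (≤-trans (n≤1+n (suc m)) (m≤m+n (suc (suc m)) (2 * i)))
    continue : (Σ (Fin n) λ u → Σ (Fin n) λ y →
                 ClosedRainbowPath (suc (suc m)) (u ◂ y ◂ p) × T (level i u)) → ⊥
    continue (u , y , C′ , u-in) = no-loop i C′ pm≡a u-in length′

  -- If every edge lies on a rainbow cycle of length 2l + 1 and 2l + 2j = K, level j is
  -- empty: an edge a x with x in level j gives a closed rainbow path from x to a.
  level-empty : ∀ l j → EveryEdgeInRainbowCycle G c (2 * l) → 2 * l + 2 * j ≡ K →
                ∀ x → ¬ T (level j x)
  level-empty l j every length x x-in with every a x (level⇒adjacent j x x-in)
  ... | C , rainbow , a-x with loop-through C rainbow a-x
  ...   | p , loop , p0≡x , pm≡a =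
    no-loop j loop pm≡a (subst (λ z → T (level j z)) (≡-sym p0≡x) x-in) length

lemma3p3 : (k l : ℕ) → 2 ≤ l → l ≤ k →
    Σ ℕ λ C → ∀ (n : ℕ) (G : Graph n) (c : EdgeColouring G) → Proper G c →
    ¬ HasRainbowCycle G c (2 * k) →
    EveryEdgeInRainbowCycle G c (2 * l) →
    ∀ a → paths2From G a ≤ C * n
lemma3p3 k l _ l≤k = (k ∸ l) * (D + D) , bound
  where
  D : ℕ
  D = threshold (2 * k)
  bound : ∀ (n : ℕ) (G : Graph n) (c : EdgeColouring G) → Proper G c →
          ¬ HasRainbowCycle G c (2 * k) → EveryEdgeInRainbowCycle G c (2 * l) →
          ∀ a → paths2From G a ≤ (k ∸ l) * (D + D) * n
  bound n G c proper no-rainbow every a =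
    paths-bound (k ∸ l) (level-empty l (k ∸ l) every (lengths-match l≤k))
    where open Growth G c proper (2 * k) no-rainbow a
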